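{- Let $(A,\rightarrow,\rightsquigarrow,1)$ be a pseudo-BE algebra and $\varphi$ a commutative pseudo-valuation on $A$. Then $\mathrm{Ker}(\varphi)=\{x\in A\mid\varphi(x)=0\}$ is a fantastic deductive system of $A$.
   Context: A pseudo-BE algebra is an algebra $(A,\rightarrow,\rightsquigarrow,1)$ of type $(2,2,0)$ such that for all $x,y,z\in A$: $x\rightarrow x=x\rightsquigarrow x=1$; $x\rightarrow 1=x\rightsquigarrow 1=1$; $1\rightarrow x=1\rightsquigarrow x=x$; $x\rightarrow(y\rightsquigarrow z)=y\rightsquigarrow(x\rightarrow z)$; $x\rightarrow y=1$ iff $x\rightsquigarrow y=1$. Put $x\vee_1 y=(x\rightarrow y)\rightsquigarrow y$, $x\vee_2 y=(x\rightsquigarrow y)\rightarrow y$. A pseudo-valuation on $A$ is a map $\varphi:A\to\mathbb{R}$ with $\varphi(1)=0$ and $\varphi(y)-\varphi(x)\le\min\{\varphi(x\rightarrow y),\varphi(x\rightsquigarrow y)\}$ for all $x,y$; it is commutative if $\varphi((x\vee_1 y)\rightarrow x)\le\varphi(y\rightarrow x)$ and $\varphi((x\vee_2 y)\rightsquigarrow x)\le\varphi(y\rightsquigarrow x)$ for all $x,y$. A deductive system is $D\subseteq A$ with $1\in D$ such that $x\in D$, $x\rightarrow y\in D$ imply $y\in D$. It is fantastic if for all $x,y$: $y\rightarrow x\in D$ implies $(x\vee_1 y)\rightarrow x\in D$, and $y\rightsquigarrow x\in D$ implies $(x\vee_2 y)\rightsquigarrow x\in D$. -}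

module Defs where

open import Level using (0ℓ)
open import Data.Product using (_×_; Σ; ∃; _,_)
open import Relation.Nullary using (¬_)
open import Relation.Binary.PropositionalEquality using (_≡_)
open import Relation.Binary.Structures using (IsTotalOrder)
open import Algebra.Structures using (IsCommutativeRing)

-- The real numbers, axiomatised as a complete ordered field
-- (unique up to isomorphism), with propositional equality.
record RealNumbers : Set₁ where
  infixl 6 _+_
  infixl 7 _*_
  infix  4 _≤_
  field
    ℝ   : Set
    _+_ : ℝ → ℝ → ℝ
    _*_ : ℝ → ℝ → ℝ
    -_  : ℝ → ℝ
    0ℝ  : ℝ
    1ℝ  : ℝ
    _≤_ : ℝ → ℝ → Set
    isCommutativeRing : IsCommutativeRing _≡_ _+_ _*_ -_ 0ℝ 1ℝ
    isTotalOrder      : IsTotalOrder _≡_ _≤_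
    0≢1               : ¬ (0ℝ ≡ 1ℝ)
    inverse           : ∀ x → ¬ (x ≡ 0ℝ) → ∃ λ y → x * y ≡ 1ℝ
    +-mono-≤          : ∀ {x y} z → x ≤ y → x + z ≤ y + z
    *-nonneg          : ∀ {x y} → 0ℝ ≤ x → 0ℝ ≤ y → 0ℝ ≤ x * y
    complete          : (P : ℝ → Set) → (∃ λ x → P x) →
                        (∃ λ b → ∀ x → P x → x ≤ b) →
                        ∃ λ s → (∀ x → P x → x ≤ s) ×
                                (∀ b → (∀ x → P x → x ≤ b) → s ≤ b)

  _-_ : ℝ → ℝ → ℝ
  x - y = x + (- y)

record PseudoBE : Set₁ where
  infixr 5 _⇒_ _⇝_
  field
    A    : Set
    _⇒_  : A → A → A
    _⇝_  : A → A → A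
    𝟏    : A
    ⇒-refl  : ∀ x → x ⇒ x ≡ 𝟏
    ⇝-refl  : ∀ x → x ⇝ x ≡ 𝟏
    ⇒-top   : ∀ x → x ⇒ 𝟏 ≡ 𝟏
    ⇝-top   : ∀ x → x ⇝ 𝟏 ≡ 𝟏
    ⇒-left  : ∀ x → 𝟏 ⇒ x ≡ x
    ⇝-left  : ∀ x → 𝟏 ⇝ x ≡ x
    exch    : ∀ x y z → x ⇒ (y ⇝ z) ≡ y ⇝ (x ⇒ z)
    ⇒→⇝    : ∀ x y → x ⇒ y ≡ 𝟏 → x ⇝ y ≡ 𝟏
    ⇝→⇒    : ∀ x y → x ⇝ y ≡ 𝟏 → x ⇒ y ≡ 𝟏

  _∨₁_ : A → A → A
  x ∨₁ y = (x ⇒ y) ⇝ y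

  _∨₂_ : A → A → A
  x ∨₂ y = (x ⇝ y) ⇒ y

module _ (R : RealNumbers) (𝔄 : PseudoBE) where
  open RealNumbers R
  open PseudoBE 𝔄

  -- φ(y) - φ(x) ≤ min{φ(x→y), φ(x⇝y)}, written as ≤ both arguments of min.
  IsPseudoValuation : (A → ℝ) → Set
  IsPseudoValuation φ =
    (φ 𝟏 ≡ 0ℝ) ×
    (∀ x y → (φ y - φ x ≤ φ (x ⇒ y)) × (φ y - φ x ≤ φ (x ⇝ y)))

  IsCommutativePV : (A → ℝ) → Set
  IsCommutativePV φ =
    IsPseudoValuation φ ×
    (∀ x y → (φ ((x ∨₁ y) ⇒ x) ≤ φ (y ⇒ x)) × (φ ((x ∨₂ y) ⇝ x) ≤ φ (y ⇝ x)))

  Ker : (A → ℝ) → A → Set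
  Ker φ x = φ x ≡ 0ℝ

  IsDeductiveSystem : (A → Set) → Set
  IsDeductiveSystem D = D 𝟏 × (∀ x y → D x → D (x ⇒ y) → D y)

  IsFantastic : (A → Set) → Set
  IsFantastic D =
    IsDeductiveSystem D ×
    (∀ x y → (D (y ⇒ x) → D ((x ∨₁ y) ⇒ x)) × (D (y ⇝ x) → D ((x ∨₂ y) ⇝ x)))

module Submission where

-- A pseudo-valuation φ is nonnegative: taking y = 1 in the
-- defining inequality gives φ 1 − φ x ≤ φ (x → 1) = φ 1, i.e. −φ x ≤ 0.
-- Hence a point x lies in Ker φ as soon as φ x ≤ 0, and in particular as
-- soon as φ x ≤ φ k for some k ∈ Ker φ.

open import Defs
open import Data.Product using (_,_; proj₁; proj₂)
open import Relation.Binary.PropositionalEquality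
open import Relation.Binary.Structures using (IsTotalOrder)
open import Algebra.Bundles using (Group)
open import Algebra.Structures using (IsCommutativeRing)
import Algebra.Properties.Group as GroupProperties

module RealFacts (R : RealNumbers) where
  open RealNumbers R
  open IsCommutativeRing isCommutativeRing
    using (+-isGroup; +-identityˡ; +-identityʳ; -‿inverseˡ)

  -- The additive group of ℝ, to reuse the library's group lemmas.
  +-group : Group _ _
  +-group = record { isGroup = +-isGroup }

  x-0≡x : ∀ x → x - 0ℝ ≡ x
  x-0≡x x = begin
    x + (- 0ℝ) ≡⟨ cong (x +_) (GroupProperties.ε⁻¹≈ε +-group) ⟩
    x + 0ℝ     ≡⟨ +-identityʳ x ⟩
    x          ∎
    where open ≡-Reasoning

  neg-nonpos⇒nonneg : ∀ x → - x ≤ 0ℝ → 0ℝ ≤ x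
  neg-nonpos⇒nonneg x h =
    subst₂ _≤_ (-‿inverseˡ x) (+-identityˡ x) (+-mono-≤ x h)

module PseudoValuation (R : RealNumbers) (𝔄 : PseudoBE) (φ : PseudoBE.A 𝔄 → RealNumbers.ℝ R)
                       (isPV : IsPseudoValuation R 𝔄 φ) where
  open RealNumbers R
  open PseudoBE 𝔄
  open RealFacts R
  open IsTotalOrder isTotalOrder using (antisym)
  open IsCommutativeRing isCommutativeRing using (+-identityˡ)

  φ𝟏≡0 : φ 𝟏 ≡ 0ℝ
  φ𝟏≡0 = proj₁ isPV

  sub-≤-⇒ : ∀ x y → φ y - φ x ≤ φ (x ⇒ y)
  sub-≤-⇒ x y = proj₁ (proj₂ isPV x y)

  -- Pseudo-valuations are nonnegative: the axiom at (x, 1) reads −φ x ≤ 0.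
  nonneg : ∀ x → 0ℝ ≤ φ x
  nonneg x = neg-nonpos⇒nonneg (φ x) -φx≤0
    where
    -φx≤0 : - φ x ≤ 0ℝ
    -φx≤0 = subst₂ _≤_ (trans (cong (_- φ x) φ𝟏≡0) (+-identityˡ (- φ x)))
                       (trans (cong φ (⇒-top x)) φ𝟏≡0)
                       (sub-≤-⇒ x 𝟏)

  -- By nonnegativity, anything bounded by an element of the kernel is in it.
  bounded-by-kernel : ∀ x k → φ x ≤ φ k → Ker R 𝔄 φ k → Ker R 𝔄 φ x
  bounded-by-kernel x k x≤k k∈ker = antisym (subst (φ x ≤_) k∈ker x≤k) (nonneg x)

  -- Ker φ is closed under modus ponens: φ y = φ y − φ x ≤ φ (x → y) = 0.
  kernel-mp : ∀ x y → Ker R 𝔄 φ x → Ker R 𝔄 φ (x ⇒ y) → Ker R 𝔄 φ y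
  kernel-mp x y x∈ker x⇒y∈ker = bounded-by-kernel y (x ⇒ y) φy≤φ[x⇒y] x⇒y∈ker
    where
    φy≤φ[x⇒y] : φ y ≤ φ (x ⇒ y)
    φy≤φ[x⇒y] = subst (_≤ φ (x ⇒ y))
                      (trans (cong (λ t → φ y - t) x∈ker) (x-0≡x (φ y)))
                      (sub-≤-⇒ x y)

  kernel-deductive : IsDeductiveSystem R 𝔄 (Ker R 𝔄 φ)
  kernel-deductive = φ𝟏≡0 , kernel-mp

module CommutativePseudoValuation (R : RealNumbers) (𝔄 : PseudoBE) (φ : PseudoBE.A 𝔄 → RealNumbers.ℝ R)
                                  (isCPV : IsCommutativePV R 𝔄 φ) where
  open PseudoBE 𝔄
  open PseudoValuation R 𝔄 φ (proj₁ isCPV) public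

  kernel-fantasticˡ : ∀ x y → Ker R 𝔄 φ (y ⇒ x) → Ker R 𝔄 φ ((x ∨₁ y) ⇒ x)
  kernel-fantasticˡ x y = bounded-by-kernel _ (y ⇒ x) (proj₁ (proj₂ isCPV x y))

  kernel-fantasticʳ : ∀ x y → Ker R 𝔄 φ (y ⇝ x) → Ker R 𝔄 φ ((x ∨₂ y) ⇝ x)
  kernel-fantasticʳ x y = bounded-by-kernel _ (y ⇝ x) (proj₂ (proj₂ isCPV x y))

proposition6p13 : (R : RealNumbers) (𝔄 : PseudoBE) (φ : PseudoBE.A 𝔄 → RealNumbers.ℝ R) →
                      IsCommutativePV R 𝔄 φ → IsFantastic R 𝔄 (Ker R 𝔄 φ)
proposition6p13 R 𝔄 φ isCPV =
  kernel-deductive , λ x y → kernel-fantasticˡ x y , kernel-fantasticʳ x y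
  where open CommutativePseudoValuation R 𝔄 φ isCPV
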